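{- Let $r:\mathcal{B}\to\mathcal{A}$ be a fibration and let $U:\mathcal{E}\to\mathcal{B}$ be a weak QCE above $r$, with full section $E$ and left adjoint $Q$. Let $a$ be an object of $\mathcal{A}$ and $F:\mathcal{B}_a\to\mathcal{B}_a$ a functor whose final coalgebra has carrier $\nu F$. Then any $E_a$-preserving lifting $\check F:\mathcal{E}_a\to\mathcal{E}_a$ of $F$ with respect to $U_a$ defines a sound coinduction rule for $\nu F$. In particular the lifting $\check F=J_a\,F^{\to}\,\rho_a$ defines a sound coinduction rule for $\nu F$.
   Context: Fibrations, cartesian morphisms, fibres, reindexing $f^*$ are as usual; a morphism is vertical if it lies above an identity. A QCE (quotient category with equality) is a fibration $V:\mathcal{D}\to\mathcal{C}$ together with a full and faithful functor $E:\mathcal{C}\to\mathcal{D}$ with $VE=Id_{\mathcal{C}}$ having a left adjoint $Q$. For fibrations $U:\mathcal{E}\to\mathcal{B}$ and $r:\mathcal{B}\to\mathcal{A}$, $U$ is a weak QCE above $r$ if there is a full and faithful $E:\mathcal{B}\to\mathcal{E}$ with $UE=Id_{\mathcal{B}}$ that preserves cartesian morphisms (with respect to $r$ and $rU$), together with a left adjoint $Q$ of $E$ whose unit is vertical with respect to $rU$ ($Q$ itself need not preserve cartesian morphisms). For $a$ in $\mathcal{A}$, $\mathcal{B}_a$ is the fibre of $r$, $\mathcal{E}_a$ the fibre of $rU$, $U_a:\mathcal{E}_a\to\mathcal{B}_a$, $E_a$, $Q_a$ the restrictions; $\eta$ is the unit of $Q_a\dashv E_a$. Define $\rho_a:\mathcal{E}_a\to\mathcal{B}_a^{\to}$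 by $\rho_aP=U_a(\eta_P)$, $J_a:\mathcal{B}_a^{\to}\to\mathcal{E}_a$ by $J_a(f:X\to Y)=f^*E_aY$ (reindexing for $U_a$), and $F^{\to}$ applies $F$ to arrows. An $E_a$-preserving lifting of $F$ is $\check F:\mathcal{E}_a\to\mathcal{E}_a$ with $U_a\check F=FU_a$ and $\check FE_a\cong E_aF$; it defines a sound coinduction rule for $\nu F$ if the functor from $F$-coalgebras to $\check F$-coalgebras sending $\alpha:X\to FX$ to $E_aX\xrightarrow{E_a\alpha}E_aFX\cong\check FE_aX$ preserves terminal objects. -}

module Defs where

open import Level using (Level; _⊔_) renaming (suc to lsuc)
open import Relation.Binary.PropositionalEquality as PE using (_≡_; refl; cong)
open import Data.Product using (Σ; _,_; proj₁; proj₂; _×_; Σ-syntax)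
open import Relation.Binary using (Rel; IsEquivalence; Setoid)
import Relation.Binary.Reasoning.Setoid as SetoidR

record Category (o ℓ e : Level) : Set (lsuc (o ⊔ ℓ ⊔ e)) where
  infixr 9 _∘_
  infix 4 _≈_
  infix 4 _⇒_
  field
    Obj : Set o
    _⇒_ : Obj → Obj → Set ℓ
    _≈_ : ∀ {A B} → Rel (A ⇒ B) e
    id : ∀ {A} → A ⇒ A
    _∘_ : ∀ {A B C} → B ⇒ C → A ⇒ B → A ⇒ C
    equiv : ∀ {A B} → IsEquivalence (_≈_ {A} {B})
    ∘-resp-≈ : ∀ {A B C} {f h : B ⇒ C} {g i : A ⇒ B} → f ≈ h → g ≈ i → f ∘ g ≈ h ∘ i
    identityˡ : ∀ {A B} {f : A ⇒ B} → id ∘ f ≈ f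
    identityʳ : ∀ {A B} {f : A ⇒ B} → f ∘ id ≈ f
    assoc : ∀ {A B C D} {f : A ⇒ B} {g : B ⇒ C} {h : C ⇒ D} →
            (h ∘ g) ∘ f ≈ h ∘ (g ∘ f)

  hom-setoid : ∀ {A B} → Setoid ℓ e
  hom-setoid {A} {B} = record { Carrier = A ⇒ B ; _≈_ = _≈_ ; isEquivalence = equiv }

  module Equiv {A B} = IsEquivalence (equiv {A} {B})

  ≡⇒hom : ∀ {A B} → A ≡ B → A ⇒ B
  ≡⇒hom refl = id

record IsFunctor {o ℓ e o′ ℓ′ e′} (C : Category o ℓ e) (D : Category o′ ℓ′ e′)
                 (F₀ : Category.Obj C → Category.Obj D)
                 (F₁ : ∀ {A B} → Category._⇒_ C A B → Category._⇒_ D (F₀ A) (F₀ B))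
                 : Set (o ⊔ ℓ ⊔ e ⊔ e′) where
  private
    module C = Category C
    module D = Category D
  field
    identity : ∀ {A} → F₁ (C.id {A}) D.≈ D.id
    homomorphism : ∀ {X Y Z} {f : X C.⇒ Y} {g : Y C.⇒ Z} →
                   F₁ (g C.∘ f) D.≈ F₁ g D.∘ F₁ f
    F-resp-≈ : ∀ {A B} {f g : A C.⇒ B} → f C.≈ g → F₁ f D.≈ F₁ g

record Functor {o ℓ e o′ ℓ′ e′} (C : Category o ℓ e) (D : Category o′ ℓ′ e′)
               : Set (o ⊔ ℓ ⊔ e ⊔ o′ ⊔ ℓ′ ⊔ e′) where
  constructor mkFunctor
  field
    F₀ : Category.Obj C → Category.Obj D
    F₁ : ∀ {A B} → Category._⇒_ C A B → Category._⇒_ D (F₀ A) (F₀ B)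
    isFunctor : IsFunctor C D F₀ F₁
  open IsFunctor isFunctor public

module _ {o ℓ e} (C : Category o ℓ e) where
  open Category C
  idF : Functor C C
  idF = record { F₀ = λ X → X ; F₁ = λ f → f
               ; isFunctor = record { identity = Equiv.refl ; homomorphism = Equiv.refl
                                    ; F-resp-≈ = λ p → p } }

infixr 9 _∘F_
_∘F_ : ∀ {o₁ ℓ₁ e₁ o₂ ℓ₂ e₂ o₃ ℓ₃ e₃}
         {C : Category o₁ ℓ₁ e₁} {D : Category o₂ ℓ₂ e₂} {K : Category o₃ ℓ₃ e₃} →
       Functor D K → Functor C D → Functor C K
_∘F_ {K = K} G F = record
  { F₀ = λ X → G.F₀ (F.F₀ X)
  ; F₁ = λ f → G.F₁ (F.F₁ f)
  ; isFunctor = record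
    { identity = K.Equiv.trans (G.F-resp-≈ F.identity) G.identity
    ; homomorphism = K.Equiv.trans (G.F-resp-≈ F.homomorphism) G.homomorphism
    ; F-resp-≈ = λ p → G.F-resp-≈ (F.F-resp-≈ p) } }
  where
    module G = Functor G
    module F = Functor F
    module K = Category K

record FunctorEq {o ℓ e o′ ℓ′ e′} {C : Category o ℓ e} {D : Category o′ ℓ′ e′}
                 (F G : Functor C D) : Set (o ⊔ ℓ ⊔ o′ ⊔ e′) where
  private
    module C = Category C
    module D = Category D
    module F = Functor F
    module G = Functor G
  field
    eq₀ : ∀ X → F.F₀ X ≡ G.F₀ X
    eq₁ : ∀ {X Y} (f : X C.⇒ Y) →
          D.≡⇒hom (eq₀ Y) D.∘ F.F₁ f D.≈ G.F₁ f D.∘ D.≡⇒hom (eq₀ X)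

record NatIso {o ℓ e o′ ℓ′ e′} {C : Category o ℓ e} {D : Category o′ ℓ′ e′}
              (F G : Functor C D) : Set (o ⊔ ℓ ⊔ ℓ′ ⊔ e′) where
  private
    module C = Category C
    module D = Category D
    module F = Functor F
    module G = Functor G
  field
    ⇒ : ∀ X → F.F₀ X D.⇒ G.F₀ X
    ⇐ : ∀ X → G.F₀ X D.⇒ F.F₀ X
    isoˡ : ∀ X → ⇐ X D.∘ ⇒ X D.≈ D.id
    isoʳ : ∀ X → ⇒ X D.∘ ⇐ X D.≈ D.id
    natural : ∀ {X Y} (f : X C.⇒ Y) → ⇒ Y D.∘ F.F₁ f D.≈ G.F₁ f D.∘ ⇒ X

record FullyFaithful {o ℓ e o′ ℓ′ e′} {C : Category o ℓ e} {D : Category o′ ℓ′ e′}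
                     (F : Functor C D) : Set (o ⊔ ℓ ⊔ e ⊔ ℓ′ ⊔ e′) where
  private
    module C = Category C
    module D = Category D
    module F = Functor F
  field
    full : ∀ {X Y} (g : F.F₀ X D.⇒ F.F₀ Y) → Σ[ f ∈ X C.⇒ Y ] (F.F₁ f D.≈ g)
    faithful : ∀ {X Y} (f g : X C.⇒ Y) → F.F₁ f D.≈ F.F₁ g → f C.≈ g

record Adjunction {o ℓ e o′ ℓ′ e′} {C : Category o ℓ e} {D : Category o′ ℓ′ e′}
                  (L : Functor C D) (R : Functor D C) : Set (o ⊔ ℓ ⊔ e ⊔ o′ ⊔ ℓ′ ⊔ e′) where
  private
    module C = Category C
    module D = Category D
    module L = Functor L
    module R = Functor R
  field
    unit : ∀ X → X C.⇒ R.F₀ (L.F₀ X)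
    counit : ∀ Y → L.F₀ (R.F₀ Y) D.⇒ Y
    unit-natural : ∀ {X Y} (f : X C.⇒ Y) →
                   R.F₁ (L.F₁ f) C.∘ unit X C.≈ unit Y C.∘ f
    counit-natural : ∀ {X Y} (f : X D.⇒ Y) →
                     f D.∘ counit X D.≈ counit Y D.∘ L.F₁ (R.F₁ f)
    zig : ∀ X → counit (L.F₀ X) D.∘ L.F₁ (unit X) D.≈ D.id
    zag : ∀ Y → R.F₁ (counit Y) C.∘ unit (R.F₀ Y) C.≈ C.id

module _ {oE ℓE eE oB ℓB eB} {𝓔 : Category oE ℓE eE} {𝓑 : Category oB ℓB eB}
         (P : Functor 𝓔 𝓑) where
  private
    module E = Category 𝓔
    module B = Category 𝓑
    module P = Functor P

  record IsCartesian {X Y : E.Obj} (f : X E.⇒ Y) : Set (oE ⊔ ℓE ⊔ eE ⊔ ℓB ⊔ eB) where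
    field
      factor : ∀ {Z} (g : Z E.⇒ Y) (h : P.F₀ Z B.⇒ P.F₀ X) →
               P.F₁ g B.≈ P.F₁ f B.∘ h → Z E.⇒ X
      factor-over : ∀ {Z} (g : Z E.⇒ Y) (h : P.F₀ Z B.⇒ P.F₀ X)
                    (eq : P.F₁ g B.≈ P.F₁ f B.∘ h) → P.F₁ (factor g h eq) B.≈ h
      factor-comm : ∀ {Z} (g : Z E.⇒ Y) (h : P.F₀ Z B.⇒ P.F₀ X)
                    (eq : P.F₁ g B.≈ P.F₁ f B.∘ h) → f E.∘ factor g h eq E.≈ g
      factor-unique : ∀ {Z} (g : Z E.⇒ Y) (h : P.F₀ Z B.⇒ P.F₀ X)
                      (eq : P.F₁ g B.≈ P.F₁ f B.∘ h) (k : Z E.⇒ X) →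
                      P.F₁ k B.≈ h → f E.∘ k E.≈ g → k E.≈ factor g h eq

  record CartesianLift {I : B.Obj} (Y : E.Obj) (f : I B.⇒ P.F₀ Y)
                       : Set (oE ⊔ ℓE ⊔ eE ⊔ oB ⊔ ℓB ⊔ eB) where
    field
      dom : E.Obj
      dom-over : P.F₀ dom ≡ I
      arr : dom E.⇒ Y
      arr-over : P.F₁ arr B.≈ f B.∘ B.≡⇒hom dom-over
      arr-cartesian : IsCartesian arr

  record Fibration : Set (oE ⊔ ℓE ⊔ eE ⊔ oB ⊔ ℓB ⊔ eB) where
    field
      lift : ∀ {I} (Y : E.Obj) (f : I B.⇒ P.F₀ Y) → CartesianLift Y f

  IsVertical : ∀ {X Y : E.Obj} → X E.⇒ Y → Set (oB ⊔ eB)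
  IsVertical {X} {Y} f = Σ[ e ∈ P.F₀ X ≡ P.F₀ Y ] (P.F₁ f B.≈ B.≡⇒hom e)

  Fibre : B.Obj → Category (oE ⊔ oB) (ℓE ⊔ eB) eE
  Fibre b = record
    { Obj = Σ[ X ∈ E.Obj ] (P.F₀ X ≡ b)
    ; _⇒_ = λ { (X , p) (Y , q) → Σ[ f ∈ X E.⇒ Y ] (B.≡⇒hom q B.∘ P.F₁ f B.≈ B.≡⇒hom p) }
    ; _≈_ = λ f g → proj₁ f E.≈ proj₁ g
    ; id = λ { {X , p} → E.id , B.Equiv.trans (B.∘-resp-≈ B.Equiv.refl P.identity) B.identityʳ }
    ; _∘_ = λ { {X , p} {Y , q} {Z , r} (g , vg) (f , vf) → (g E.∘ f) ,
                 B.Equiv.trans (B.∘-resp-≈ B.Equiv.refl P.homomorphism)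
                 (B.Equiv.trans (B.Equiv.sym B.assoc)
                 (B.Equiv.trans (B.∘-resp-≈ vg B.Equiv.refl) vf)) }
    ; equiv = record { refl = E.Equiv.refl ; sym = E.Equiv.sym ; trans = E.Equiv.trans }
    ; ∘-resp-≈ = E.∘-resp-≈
    ; identityˡ = E.identityˡ
    ; identityʳ = E.identityʳ
    ; assoc = E.assoc
    }

-- Weak QCE above r (Definition in the context): U : 𝓔 → 𝓑, r : 𝓑 → 𝓐
-- (both assumed to be fibrations separately, see the statement)

record WeakQCE {oA ℓA eA oB ℓB eB oE ℓE eE}
               {𝓐 : Category oA ℓA eA} {𝓑 : Category oB ℓB eB} {𝓔 : Category oE ℓE eE}
               (r : Functor 𝓑 𝓐) (U : Functor 𝓔 𝓑)
               : Set (oA ⊔ ℓA ⊔ eA ⊔ oB ⊔ ℓB ⊔ eB ⊔ oE ⊔ ℓE ⊔ eE) where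
  field
    E : Functor 𝓑 𝓔
    E-fullyFaithful : FullyFaithful E
    UE≡Id : FunctorEq (U ∘F E) (idF 𝓑)
    E-cartesian : ∀ {X Y} {f : Category._⇒_ 𝓑 X Y} →
                  IsCartesian r f → IsCartesian (r ∘F U) (Functor.F₁ E f)
    Q : Functor 𝓔 𝓑
    Q⊣E : Adjunction Q E
    unit-vertical : ∀ X → IsVertical (r ∘F U) (Adjunction.unit Q⊣E X)

module HomLemmas {o ℓ e} (C : Category o ℓ e) where
  open Category C

  ≡⇒hom-trans : ∀ {A B D} (p : A ≡ B) (q : B ≡ D) →
                ≡⇒hom (PE.trans p q) ≈ ≡⇒hom q ∘ ≡⇒hom p
  ≡⇒hom-trans refl q = Equiv.sym identityʳ

  ≡⇒hom-symˡ : ∀ {A B} (p : A ≡ B) → ≡⇒hom (PE.sym p) ∘ ≡⇒hom p ≈ id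
  ≡⇒hom-symˡ refl = identityʳ

  ≡⇒hom-symʳ : ∀ {A B} (p : A ≡ B) → ≡⇒hom p ∘ ≡⇒hom (PE.sym p) ≈ id
  ≡⇒hom-symʳ refl = identityʳ

  ≡⇒hom-trans-sym : ∀ {A B D} (p : A ≡ B) (q : A ≡ D) →
                    ≡⇒hom (PE.trans (PE.sym p) q) ∘ ≡⇒hom p ≈ ≡⇒hom q
  ≡⇒hom-trans-sym refl q = identityʳ

module FunctorLemmas {o ℓ e o′ ℓ′ e′} {C : Category o ℓ e} {D : Category o′ ℓ′ e′}
                     (F : Functor C D) where
  private
    module C = Category C
    module D = Category D
  open Functor F

  F-≡⇒hom : ∀ {A B} (p : A ≡ B) → F₁ (C.≡⇒hom p) D.≈ D.≡⇒hom (cong F₀ p)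
  F-≡⇒hom refl = identity

module _ {o ℓ e} (C : Category o ℓ e) where
  open Category C

  record Arr : Set (o ⊔ ℓ) where
    constructor arrow
    field
      {src} : Obj
      {tgt} : Obj
      arr : src ⇒ tgt

  record Square (f g : Arr) : Set (ℓ ⊔ e) where
    constructor square
    private
      module f = Arr f
      module g = Arr g
    field
      top : f.src ⇒ g.src
      bot : f.tgt ⇒ g.tgt
      comm : bot ∘ f.arr ≈ g.arr ∘ top

module _ {o ℓ e o′ ℓ′ e′} {C : Category o ℓ e} {D : Category o′ ℓ′ e′}
         (F : Functor C D) where
  private
    module C = Category C
    module D = Category D
    module F = Functor F

  F→₀ : Arr C → Arr D
  F→₀ (arrow f) = arrow (F.F₁ f)

  F→₁ : ∀ {f g} → Square C f g → Square D (F→₀ f) (F→₀ g)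
  F→₁ {arrow f} {arrow g} (square u v c) =
    square (F.F₁ u) (F.F₁ v)
      (D.Equiv.trans (D.Equiv.sym F.homomorphism)
        (D.Equiv.trans (F.F-resp-≈ c) F.homomorphism))

module _ {o ℓ e} {C : Category o ℓ e} (F : Functor C C) where
  private
    module C = Category C
    module F = Functor F

  record Coalgebra : Set (o ⊔ ℓ) where
    constructor coalgebra
    field
      carrier : C.Obj
      structure : carrier C.⇒ F.F₀ carrier

  record CoalgebraHom (X Y : Coalgebra) : Set (ℓ ⊔ e) where
    private
      module X = Coalgebra X
      module Y = Coalgebra Y
    field
      hom : X.carrier C.⇒ Y.carrier
      commutes : F.F₁ hom C.∘ X.structure C.≈ Y.structure C.∘ hom

  IsTerminalCoalgebra : Coalgebra → Set (o ⊔ ℓ ⊔ e)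
  IsTerminalCoalgebra T =
    ∀ X → Σ[ h ∈ CoalgebraHom X T ]
            (∀ (k : CoalgebraHom X T) →
               CoalgebraHom.hom k C.≈ CoalgebraHom.hom h)

module WeakQCEFibre
  {oA ℓA eA oB ℓB eB oE ℓE eE}
  {𝓐 : Category oA ℓA eA} {𝓑 : Category oB ℓB eB} {𝓔 : Category oE ℓE eE}
  (r : Functor 𝓑 𝓐) (U : Functor 𝓔 𝓑)
  (fibU : Fibration U) (W : WeakQCE r U)
  (a : Category.Obj 𝓐) where

  private
    module A = Category 𝓐
    module B = Category 𝓑
    module 𝓔 = Category 𝓔
    module r = Functor r
    module U = Functor U
    module W = WeakQCE W
    module E = Functor W.E
    module Q = Functor W.Q
    module Adj = Adjunction W.Q⊣E
    module UE = FunctorEq W.UE≡Id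
    module rU = Functor (r ∘F U)
    open HomLemmas
    open FunctorLemmas

  𝓑ₐ : Category (oB ⊔ oA) (ℓB ⊔ eA) eB
  𝓑ₐ = Fibre r a

  𝓔ₐ : Category (oE ⊔ oA) (ℓE ⊔ eA) eE
  𝓔ₐ = Fibre (r ∘F U) a

  private
    module Bₐ = Category 𝓑ₐ
    module Eₐ = Category 𝓔ₐ

  Uₐ : Functor 𝓔ₐ 𝓑ₐ
  Uₐ = record
    { F₀ = λ { (X , p) → U.F₀ X , p }
    ; F₁ = λ { (f , v) → U.F₁ f , v }
    ; isFunctor = record { identity = U.identity ; homomorphism = U.homomorphism
                         ; F-resp-≈ = U.F-resp-≈ } }

  ue : ∀ X → U.F₀ (E.F₀ X) ≡ X
  ue = UE.eq₀

  private
    Eₐ-vert : ∀ {X′ Y′ X Y} (ux : X′ ≡ X) (uy : Y′ ≡ Y) (m : X′ B.⇒ Y′) (f : X B.⇒ Y)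
              (p : r.F₀ X ≡ a) (q : r.F₀ Y ≡ a) →
              B.≡⇒hom uy B.∘ m B.≈ f B.∘ B.≡⇒hom ux →
              A.≡⇒hom q A.∘ r.F₁ f A.≈ A.≡⇒hom p →
              A.≡⇒hom (PE.trans (cong r.F₀ uy) q) A.∘ r.F₁ m A.≈
              A.≡⇒hom (PE.trans (cong r.F₀ ux) p)
    Eₐ-vert refl refl m f p q eqm v =
      A.Equiv.trans (A.∘-resp-≈ A.Equiv.refl
        (r.F-resp-≈ (B.Equiv.trans (B.Equiv.sym B.identityˡ)
                      (B.Equiv.trans eqm B.identityʳ)))) v

  Eₐ : Functor 𝓑ₐ 𝓔ₐ
  Eₐ = record
    { F₀ = λ { (X , p) → E.F₀ X , PE.trans (cong r.F₀ (ue X)) p }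
    ; F₁ = λ { {X , p} {Y , q} (f , v) →
               E.F₁ f , Eₐ-vert (ue X) (ue Y) (U.F₁ (E.F₁ f)) f p q (UE.eq₁ f) v }
    ; isFunctor = record { identity = E.identity ; homomorphism = E.homomorphism
                         ; F-resp-≈ = E.F-resp-≈ } }

  η : ∀ X → X 𝓔.⇒ E.F₀ (Q.F₀ X)
  η = Adj.unit

  ρ₀ : Eₐ.Obj → Arr 𝓑ₐ
  ρ₀ (X , p) =
    arrow {src = U.F₀ X , p}
          {tgt = U.F₀ (E.F₀ (Q.F₀ X)) , PE.trans (PE.sym (proj₁ (W.unit-vertical X))) p}
          (U.F₁ (η X) ,
           A.Equiv.trans (A.∘-resp-≈ A.Equiv.refl (proj₂ (W.unit-vertical X)))
                         (≡⇒hom-trans-sym 𝓐 (proj₁ (W.unit-vertical X)) p))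

  private
    ρ-vert : ∀ {x x′ y y′} (eX : x ≡ x′) (eY : y ≡ y′) (p : x ≡ a) (q : y ≡ a)
             (g : x A.⇒ y) (m : x′ A.⇒ y′) →
             m A.∘ A.≡⇒hom eX A.≈ A.≡⇒hom eY A.∘ g →
             A.≡⇒hom q A.∘ g A.≈ A.≡⇒hom p →
             A.≡⇒hom (PE.trans (PE.sym eY) q) A.∘ m A.≈
             A.≡⇒hom (PE.trans (PE.sym eX) p)
    ρ-vert refl refl p q g m N v =
      A.Equiv.trans (A.∘-resp-≈ A.Equiv.refl
        (A.Equiv.trans (A.Equiv.sym A.identityʳ) (A.Equiv.trans N A.identityˡ))) v

    rU-unit-nat : ∀ {X Y} (g : X 𝓔.⇒ Y) →
      rU.F₁ (E.F₁ (Q.F₁ g)) A.∘ A.≡⇒hom (proj₁ (W.unit-vertical X)) A.≈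
      A.≡⇒hom (proj₁ (W.unit-vertical Y)) A.∘ rU.F₁ g
    rU-unit-nat {X} {Y} g =
      A.Equiv.trans (A.∘-resp-≈ A.Equiv.refl (A.Equiv.sym (proj₂ (W.unit-vertical X))))
      (A.Equiv.trans (A.Equiv.sym rU.homomorphism)
      (A.Equiv.trans (rU.F-resp-≈ (Adj.unit-natural g))
      (A.Equiv.trans rU.homomorphism
        (A.∘-resp-≈ (proj₂ (W.unit-vertical Y)) A.Equiv.refl))))

  ρ₁ : ∀ {P P′} → P Eₐ.⇒ P′ → Square 𝓑ₐ (ρ₀ P) (ρ₀ P′)
  ρ₁ {X , p} {Y , q} (g , v) =
    square (U.F₁ g , v)
           (U.F₁ (E.F₁ (Q.F₁ g)) ,
            ρ-vert (proj₁ (W.unit-vertical X)) (proj₁ (W.unit-vertical Y)) p q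
                   (rU.F₁ g) (rU.F₁ (E.F₁ (Q.F₁ g))) (rU-unit-nat g) v)
           (B.Equiv.trans (B.Equiv.sym U.homomorphism)
             (B.Equiv.trans (U.F-resp-≈ (Adj.unit-natural g)) U.homomorphism))

  -- Jₐ : 𝓑ₐ^→ → 𝓔ₐ,  Jₐ(f : X → Y) = f* (Eₐ Y), reindexing along the chosen
  -- U-cartesian lift (which lies in 𝓔ₐ since f is vertical)
  Jlift : (f : Arr 𝓑ₐ) → CartesianLift U (E.F₀ (proj₁ (Arr.tgt f)))
                           (B.≡⇒hom (PE.sym (ue (proj₁ (Arr.tgt f)))) B.∘ proj₁ (Arr.arr f))
  Jlift f = Fibration.lift fibU (E.F₀ (proj₁ (Arr.tgt f)))
              (B.≡⇒hom (PE.sym (ue (proj₁ (Arr.tgt f)))) B.∘ proj₁ (Arr.arr f))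

  J₀ : Arr 𝓑ₐ → Eₐ.Obj
  J₀ f = CartesianLift.dom (Jlift f) ,
         PE.trans (cong r.F₀ (CartesianLift.dom-over (Jlift f))) (proj₂ (Arr.src f))

  private
    J-cond : ∀ {X X′ Y Y′ Y₁ Y₁′ Z Z′}
             (f : X B.⇒ Y) (f′ : X′ B.⇒ Y′) (u : X B.⇒ X′) (v : Y B.⇒ Y′) →
             v B.∘ f B.≈ f′ B.∘ u →
             (ueY : Y₁ ≡ Y) (ueY′ : Y₁′ ≡ Y′) (m : Y₁ B.⇒ Y₁′) →
             B.≡⇒hom ueY′ B.∘ m B.≈ v B.∘ B.≡⇒hom ueY →
             (zo : Z ≡ X) (zo′ : Z′ ≡ X′) (φ : Z B.⇒ Y₁) (φ′ : Z′ B.⇒ Y₁′) →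
             φ B.≈ (B.≡⇒hom (PE.sym ueY) B.∘ f) B.∘ B.≡⇒hom zo →
             φ′ B.≈ (B.≡⇒hom (PE.sym ueY′) B.∘ f′) B.∘ B.≡⇒hom zo′ →
             m B.∘ φ B.≈ φ′ B.∘ ((B.≡⇒hom (PE.sym zo′) B.∘ u) B.∘ B.≡⇒hom zo)
    J-cond f f′ u v c refl refl m eqv refl refl φ φ′ φo φ′o =
      B.Equiv.trans (B.∘-resp-≈ (clean eqv) (B.Equiv.trans φo clean′))
      (B.Equiv.trans c
        (B.∘-resp-≈ (B.Equiv.sym (B.Equiv.trans φ′o clean′)) (B.Equiv.sym clean′)))
      where
        clean′ : ∀ {P R} {x : P B.⇒ R} → (B.id B.∘ x) B.∘ B.id B.≈ x
        clean′ = B.Equiv.trans B.identityʳ B.identityˡ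
        clean : B.id B.∘ m B.≈ v B.∘ B.id → m B.≈ v
        clean e = B.Equiv.trans (B.Equiv.sym B.identityˡ) (B.Equiv.trans e B.identityʳ)

    J-vert : ∀ {Z Z′ X X′} (zo : Z ≡ X) (zo′ : Z′ ≡ X′) (pX : r.F₀ X ≡ a) (pX′ : r.F₀ X′ ≡ a)
             (u : X B.⇒ X′) → A.≡⇒hom pX′ A.∘ r.F₁ u A.≈ A.≡⇒hom pX →
             (m : Z B.⇒ Z′) → m B.≈ (B.≡⇒hom (PE.sym zo′) B.∘ u) B.∘ B.≡⇒hom zo →
             A.≡⇒hom (PE.trans (cong r.F₀ zo′) pX′) A.∘ r.F₁ m A.≈
             A.≡⇒hom (PE.trans (cong r.F₀ zo) pX)
    J-vert refl refl pX pX′ u vu m mo =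
      A.Equiv.trans (A.∘-resp-≈ A.Equiv.refl
        (r.F-resp-≈ (B.Equiv.trans mo (B.Equiv.trans B.identityʳ B.identityˡ)))) vu

  J₁ : ∀ {f g} → Square 𝓑ₐ f g → J₀ f Eₐ.⇒ J₀ g
  J₁ {arrow {X , pX} {Y , pY} (f , vf)} {arrow {X′ , pX′} {Y′ , pY′} (f′ , vf′)}
     (square (u , vu) (v , vv) c) =
    k , J-vert Lo L′o pX pX′ u vu (U.F₁ k) (L′c.factor-over g h cond)
    where
      L = Jlift (arrow {src = X , pX} {tgt = Y , pY} (f , vf))
      L′ = Jlift (arrow {src = X′ , pX′} {tgt = Y′ , pY′} (f′ , vf′))
      module L = CartesianLift L
      module L′ = CartesianLift L′
      module L′c = IsCartesian L′.arr-cartesian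
      Lo = L.dom-over
      L′o = L′.dom-over
      g = E.F₁ v 𝓔.∘ L.arr
      h = (B.≡⇒hom (PE.sym L′o) B.∘ u) B.∘ B.≡⇒hom Lo
      cond : U.F₁ g B.≈ U.F₁ L′.arr B.∘ h
      cond = B.Equiv.trans U.homomorphism
               (J-cond f f′ u v c (ue Y) (ue Y′) (U.F₁ (E.F₁ v)) (UE.eq₁ v)
                       Lo L′o (U.F₁ L.arr) (U.F₁ L′.arr) L.arr-over L′.arr-over)
      k = L′c.factor g h cond

  JFρ₀ : Functor 𝓑ₐ 𝓑ₐ → Eₐ.Obj → Eₐ.Obj
  JFρ₀ F P = J₀ (F→₀ F (ρ₀ P))

  JFρ₁ : (F : Functor 𝓑ₐ 𝓑ₐ) → ∀ {P P′} → P Eₐ.⇒ P′ → JFρ₀ F P Eₐ.⇒ JFρ₀ F P′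
  JFρ₁ F f = J₁ (F→₁ F (ρ₁ f))

  record IsEₐPreservingLifting (F : Functor 𝓑ₐ 𝓑ₐ) (F̌ : Functor 𝓔ₐ 𝓔ₐ)
         : Set (oA ⊔ ℓA ⊔ eA ⊔ oB ⊔ ℓB ⊔ eB ⊔ oE ⊔ ℓE ⊔ eE) where
    field
      lifts : FunctorEq (Uₐ ∘F F̌) (F ∘F Uₐ)
      preservesE : NatIso (F̌ ∘F Eₐ) (Eₐ ∘F F)

  liftCoalgebra : {F : Functor 𝓑ₐ 𝓑ₐ} {F̌ : Functor 𝓔ₐ 𝓔ₐ} →
                  IsEₐPreservingLifting F F̌ → Coalgebra F → Coalgebra F̌
  liftCoalgebra {F} {F̌} L (coalgebra X α) =
    coalgebra (Functor.F₀ Eₐ X)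
              (Eₐ._∘_ {A = Functor.F₀ Eₐ X} {B = Functor.F₀ Eₐ (Functor.F₀ F X)}
                      {C = Functor.F₀ F̌ (Functor.F₀ Eₐ X)}
                      (NatIso.⇐ (IsEₐPreservingLifting.preservesE L) X) (Functor.F₁ Eₐ α))

  -- F̌ defines a sound coinduction rule for νF: the above functor
  -- preserves terminal objects
  SoundCoinduction : {F : Functor 𝓑ₐ 𝓑ₐ} {F̌ : Functor 𝓔ₐ 𝓔ₐ} →
                     IsEₐPreservingLifting F F̌ → Set _
  SoundCoinduction {F} {F̌} L =
    ∀ (T : Coalgebra F) → IsTerminalCoalgebra F T →
      IsTerminalCoalgebra F̌ (liftCoalgebra L T)

-- Soundness of an Eₐ-preserving lifting F̌ uses only that Eₐ has a left adjoint Qₐ (Q ⊣ E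
-- restricts to the fibre over a because its unit is vertical) and that F̌Eₐ ≅ EₐF.  An
-- F̌-coalgebra β : P → F̌P then transposes to an F-coalgebra on QₐP, and F̌-coalgebra maps
-- P → EₐνF correspond exactly to F-coalgebra maps QₐP → νF, of which there is exactly one.
--
-- For F̌ = Jₐ F^→ ρₐ, functoriality follows from uniqueness of cartesian factorisations, and
-- Uₐ F̌ = F Uₐ because Jₐ f lies over the domain of f.  Since E is full, the unit of Q ⊣ E
-- is invertible at E-objects, so ρₐ(EₐY) : UₐEₐY → T is an isomorphism.  A cartesian
-- morphism over an isomorphism is one, hence F̌EₐY = (Fρₐ(EₐY))* EₐFT ≅ EₐFT ≅ EₐFY.
module Submission where

open import Defs
open import Level using (Level; _⊔_)
open import Data.Product using (_,_; proj₁; proj₂; _×_; Σ-syntax)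
open import Relation.Binary.PropositionalEquality as PE using (_≡_; refl; cong)
open import Axiom.UniquenessOfIdentityProofs.WithK using (uip)
import Relation.Binary.Reasoning.Setoid as SetoidR

module CategoryLemmas {o ℓ e} (C : Category o ℓ e) where
  open Category C
  open HomLemmas C
  private module HomReasoning {A B} = SetoidR (hom-setoid {A} {B})

  IsTransport : ∀ {A B} → A ⇒ B → Set _
  IsTransport {A} {B} f = Σ[ p ∈ A ≡ B ] (f ≈ ≡⇒hom p)

  ≡⇒hom-isTransport : ∀ {A B} (p : A ≡ B) → IsTransport (≡⇒hom p)
  ≡⇒hom-isTransport p = p , Equiv.refl

  isTransport-resp-≈ : ∀ {A B} {f g : A ⇒ B} → f ≈ g → IsTransport f → IsTransport g
  isTransport-resp-≈ f≈g (p , f≈p) = p , Equiv.trans (Equiv.sym f≈g) f≈p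

  isTransport-∘ : ∀ {A B D} {f : A ⇒ B} {g : B ⇒ D} →
                  IsTransport g → IsTransport f → IsTransport (g ∘ f)
  isTransport-∘ (refl , g≈id) (refl , f≈id) = refl , Equiv.trans (∘-resp-≈ g≈id f≈id) identityˡ

  isTransport-cancelʳ : ∀ {A B D} {f : A ⇒ B} {g : B ⇒ D} →
                        IsTransport (g ∘ f) → IsTransport f → IsTransport g
  isTransport-cancelʳ (refl , gf≈id) (refl , f≈id) = refl ,
    Equiv.trans (Equiv.sym identityʳ) (Equiv.trans (∘-resp-≈ Equiv.refl (Equiv.sym f≈id)) gf≈id)

  isTransport⇒triangle : ∀ {A B D} {f : A ⇒ B} → IsTransport f →
                         (p : A ≡ D) (q : B ≡ D) → ≡⇒hom q ∘ f ≈ ≡⇒hom p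
  isTransport⇒triangle (refl , f≈id) refl refl = Equiv.trans identityˡ f≈id

  triangle⇒isTransport : ∀ {A B D} {f : A ⇒ B} (p : A ≡ D) (q : B ≡ D) →
                         ≡⇒hom q ∘ f ≈ ≡⇒hom p → IsTransport f
  triangle⇒isTransport p refl qf≈p = p , Equiv.trans (Equiv.sym identityˡ) qf≈p

  conjugate : ∀ {A A′ B B′} → A ≡ A′ → B ≡ B′ → A′ ⇒ B′ → A ⇒ B
  conjugate p q t = (≡⇒hom (PE.sym q) ∘ t) ∘ ≡⇒hom p

  conjugate-resp-≈ : ∀ {A A′ B B′} (p : A ≡ A′) (q : B ≡ B′) {t t′ : A′ ⇒ B′} →
                     t ≈ t′ → conjugate p q t ≈ conjugate p q t′
  conjugate-resp-≈ p q t≈t′ = ∘-resp-≈ (∘-resp-≈ Equiv.refl t≈t′) Equiv.refl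

  conjugate-refl : ∀ {A B} {t : A ⇒ B} → conjugate refl refl t ≈ t
  conjugate-refl = Equiv.trans identityʳ identityˡ

  conjugate-id : ∀ {A A′} (p : A ≡ A′) → conjugate p p id ≈ id
  conjugate-id refl = conjugate-refl

  conjugate-∘ : ∀ {A A′ B B′ D D′} (p : A ≡ A′) (q : B ≡ B′) (w : D ≡ D′)
                (t₁ : A′ ⇒ B′) (t₂ : B′ ⇒ D′) →
                conjugate q w t₂ ∘ conjugate p q t₁ ≈ conjugate p w (t₂ ∘ t₁)
  conjugate-∘ refl refl refl t₁ t₂ =
    Equiv.trans (∘-resp-≈ conjugate-refl conjugate-refl) (Equiv.sym conjugate-refl)

  ≡⇒hom-∘-conjugate : ∀ {A A′ B B′} (p : A ≡ A′) (q : B ≡ B′) (t : A′ ⇒ B′) →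
                      ≡⇒hom q ∘ conjugate p q t ≈ t ∘ ≡⇒hom p
  ≡⇒hom-∘-conjugate refl refl t = Equiv.trans identityˡ (∘-resp-≈ identityˡ Equiv.refl)

  record IsIso {A B} (f : A ⇒ B) : Set (ℓ ⊔ e) where
    field
      inv : B ⇒ A
      isoˡ : inv ∘ f ≈ id
      isoʳ : f ∘ inv ≈ id

  ≡⇒hom-isIso : ∀ {A B} (p : A ≡ B) → IsIso (≡⇒hom p)
  ≡⇒hom-isIso p = record { inv = ≡⇒hom (PE.sym p) ; isoˡ = ≡⇒hom-symˡ p ; isoʳ = ≡⇒hom-symʳ p }

  isIso-resp-≈ : ∀ {A B} {f g : A ⇒ B} → f ≈ g → IsIso f → IsIso g
  isIso-resp-≈ f≈g F = record
    { inv = F.inv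
    ; isoˡ = Equiv.trans (∘-resp-≈ Equiv.refl (Equiv.sym f≈g)) F.isoˡ
    ; isoʳ = Equiv.trans (∘-resp-≈ (Equiv.sym f≈g) Equiv.refl) F.isoʳ }
    where module F = IsIso F

  inv-isIso : ∀ {A B} {f : A ⇒ B} (F : IsIso f) → IsIso (IsIso.inv F)
  inv-isIso {f = f} F = record { inv = f ; isoˡ = IsIso.isoʳ F ; isoʳ = IsIso.isoˡ F }

  isIso-∘ : ∀ {A B D} {f : A ⇒ B} {g : B ⇒ D} → IsIso g → IsIso f → IsIso (g ∘ f)
  isIso-∘ {f = f} {g} G F = record
    { inv = F.inv ∘ G.inv
    ; isoˡ = cancel F.inv G.inv g f G.isoˡ F.isoˡ
    ; isoʳ = cancel g f F.inv G.inv F.isoʳ G.isoʳ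
    }
    where
      module F = IsIso F
      module G = IsIso G
      open HomReasoning
      cancel : ∀ {X Y Z} (a : Y ⇒ X) (b : Z ⇒ Y) (c : Y ⇒ Z) (d : X ⇒ Y) →
               b ∘ c ≈ id → a ∘ d ≈ id → (a ∘ b) ∘ (c ∘ d) ≈ id
      cancel a b c d bc≈id ad≈id = begin
        (a ∘ b) ∘ (c ∘ d) ≈⟨ assoc ⟩
        a ∘ (b ∘ (c ∘ d)) ≈⟨ ∘-resp-≈ Equiv.refl (Equiv.sym assoc) ⟩
        a ∘ ((b ∘ c) ∘ d) ≈⟨ ∘-resp-≈ Equiv.refl (∘-resp-≈ bc≈id Equiv.refl) ⟩
        a ∘ (id ∘ d)      ≈⟨ ∘-resp-≈ Equiv.refl identityˡ ⟩
        a ∘ d             ≈⟨ ad≈id ⟩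
        id                ∎

  inverse-commutes : ∀ {A B A′ B′} {f : A ⇒ B} {f′ : A′ ⇒ B′} {u : A ⇒ A′} {v : B ⇒ B′} →
                     (F : IsIso f) (F′ : IsIso f′) → v ∘ f ≈ f′ ∘ u →
                     IsIso.inv F′ ∘ v ≈ u ∘ IsIso.inv F
  inverse-commutes {f = f} {f′} {u} {v} F F′ sq = begin
    F′.inv ∘ v                    ≈⟨ Equiv.sym identityʳ ⟩
    (F′.inv ∘ v) ∘ id             ≈⟨ ∘-resp-≈ Equiv.refl (Equiv.sym F.isoʳ) ⟩
    (F′.inv ∘ v) ∘ (f ∘ F.inv)    ≈⟨ assoc ⟩
    F′.inv ∘ (v ∘ (f ∘ F.inv))    ≈⟨ ∘-resp-≈ Equiv.refl (Equiv.sym assoc) ⟩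
    F′.inv ∘ ((v ∘ f) ∘ F.inv)    ≈⟨ ∘-resp-≈ Equiv.refl (∘-resp-≈ sq Equiv.refl) ⟩
    F′.inv ∘ ((f′ ∘ u) ∘ F.inv)   ≈⟨ ∘-resp-≈ Equiv.refl assoc ⟩
    F′.inv ∘ (f′ ∘ (u ∘ F.inv))   ≈⟨ Equiv.sym assoc ⟩
    (F′.inv ∘ f′) ∘ (u ∘ F.inv)   ≈⟨ Equiv.trans (∘-resp-≈ F′.isoˡ Equiv.refl) identityˡ ⟩
    u ∘ F.inv                     ∎
    where
      module F = IsIso F
      module F′ = IsIso F′
      open HomReasoning

  isIso-shiftˡ : ∀ {A B D} {f : B ⇒ D} {a : A ⇒ B} {b : A ⇒ D} (F : IsIso f) →
                 f ∘ a ≈ b → a ≈ IsIso.inv F ∘ b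
  isIso-shiftˡ {f = f} {a} {b} F fa≈b = begin
    a               ≈⟨ Equiv.sym identityˡ ⟩
    id ∘ a          ≈⟨ ∘-resp-≈ (Equiv.sym (IsIso.isoˡ F)) Equiv.refl ⟩
    (F.inv ∘ f) ∘ a ≈⟨ assoc ⟩
    F.inv ∘ (f ∘ a) ≈⟨ ∘-resp-≈ Equiv.refl fa≈b ⟩
    F.inv ∘ b       ∎
    where
      module F = IsIso F
      open HomReasoning

  isIso-unshiftˡ : ∀ {A B D} {f : B ⇒ D} {a : A ⇒ B} {b : A ⇒ D} (F : IsIso f) →
                   a ≈ IsIso.inv F ∘ b → f ∘ a ≈ b
  isIso-unshiftˡ {f = f} {a} {b} F a≈inv-b = begin
    f ∘ a           ≈⟨ ∘-resp-≈ Equiv.refl a≈inv-b ⟩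
    f ∘ (F.inv ∘ b) ≈⟨ Equiv.sym assoc ⟩
    (f ∘ F.inv) ∘ b ≈⟨ ∘-resp-≈ F.isoʳ Equiv.refl ⟩
    id ∘ b          ≈⟨ identityˡ ⟩
    b               ∎
    where
      module F = IsIso F
      open HomReasoning

natIso-isIso : ∀ {o ℓ e o′ ℓ′ e′} {C : Category o ℓ e} {D : Category o′ ℓ′ e′}
               {F G : Functor C D} (θ : NatIso F G) (X : Category.Obj C) →
               CategoryLemmas.IsIso D (NatIso.⇒ θ X)
natIso-isIso θ X = record { inv = NatIso.⇐ θ X ; isoˡ = NatIso.isoˡ θ X ; isoʳ = NatIso.isoʳ θ X }

module FunctorPreservation {o ℓ e o′ ℓ′ e′} {C : Category o ℓ e} {D : Category o′ ℓ′ e′}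
                           (F : Functor C D) where
  private
    module C = Category C
    module D = Category D
    module C′ = CategoryLemmas C
    module D′ = CategoryLemmas D
  open Functor F

  F-resp-isTransport : ∀ {A B} {f : A C.⇒ B} → C′.IsTransport f → D′.IsTransport (F₁ f)
  F-resp-isTransport (refl , f≈id) = refl , D.Equiv.trans (F-resp-≈ f≈id) identity

  F-resp-isIso : ∀ {A B} {f : A C.⇒ B} → C′.IsIso f → D′.IsIso (F₁ f)
  F-resp-isIso {f = f} I = record
    { inv = F₁ I.inv
    ; isoˡ = D.Equiv.trans (D.Equiv.sym homomorphism) (D.Equiv.trans (F-resp-≈ I.isoˡ) identity)
    ; isoʳ = D.Equiv.trans (D.Equiv.sym homomorphism) (D.Equiv.trans (F-resp-≈ I.isoʳ) identity)
    }
    where module I = C′.IsIso I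

  F-resp-square : ∀ {A B B′ Z} {f : A C.⇒ B} {g : B C.⇒ Z} {h : A C.⇒ B′} {k : B′ C.⇒ Z} →
                  g C.∘ f C.≈ k C.∘ h → F₁ g D.∘ F₁ f D.≈ F₁ k D.∘ F₁ h
  F-resp-square sq =
    D.Equiv.trans (D.Equiv.sym homomorphism) (D.Equiv.trans (F-resp-≈ sq) homomorphism)

-- IsVertical P f is by definition IsTransport (P.F₁ f).
module VerticalLemmas {oE ℓE eE oB ℓB eB} {𝓔 : Category oE ℓE eE} {𝓑 : Category oB ℓB eB}
                      (P : Functor 𝓔 𝓑) where
  private
    module E = Category 𝓔
    module B = Category 𝓑
    module P = Functor P
    module B′ = CategoryLemmas 𝓑

  ≡⇒hom-isVertical : ∀ {X Y} (p : X ≡ Y) → IsVertical P (E.≡⇒hom p)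
  ≡⇒hom-isVertical p =
    FunctorPreservation.F-resp-isTransport P (CategoryLemmas.≡⇒hom-isTransport 𝓔 p)

  isVertical-resp-≈ : ∀ {X Y} {f g : X E.⇒ Y} → f E.≈ g → IsVertical P f → IsVertical P g
  isVertical-resp-≈ f≈g = B′.isTransport-resp-≈ (P.F-resp-≈ f≈g)

  isVertical-∘ : ∀ {X Y Z} {f : X E.⇒ Y} {g : Y E.⇒ Z} →
                 IsVertical P g → IsVertical P f → IsVertical P (g E.∘ f)
  isVertical-∘ vg vf = B′.isTransport-resp-≈ (B.Equiv.sym P.homomorphism) (B′.isTransport-∘ vg vf)

  isVertical-cancelʳ : ∀ {X Y Z} {f : X E.⇒ Y} {g : Y E.⇒ Z} →
                       IsVertical P (g E.∘ f) → IsVertical P f → IsVertical P g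
  isVertical-cancelʳ vgf vf = B′.isTransport-cancelʳ (B′.isTransport-resp-≈ P.homomorphism vgf) vf

module FibreLemmas {oE ℓE eE oB ℓB eB} {𝓔 : Category oE ℓE eE} {𝓑 : Category oB ℓB eB}
                   (P : Functor 𝓔 𝓑) (b : Category.Obj 𝓑) where
  private
    module E = Category 𝓔
    module B = Category 𝓑
    module P = Functor P
    module Pb = Category (Fibre P b)
    module P↓ = VerticalLemmas P
    module E′ = CategoryLemmas 𝓔
    module B′ = CategoryLemmas 𝓑

  fibre-hom-isVertical : ∀ {X Y} (f : X Pb.⇒ Y) → IsVertical P (proj₁ f)
  fibre-hom-isVertical {_ , p} {_ , q} (_ , v) = B′.triangle⇒isTransport p q v

  fibre-hom : ∀ {X Y} (f : proj₁ X E.⇒ proj₁ Y) → IsVertical P f → X Pb.⇒ Y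
  fibre-hom {_ , p} {_ , q} f v = f , B′.isTransport⇒triangle v p q

  fibre-obj-≡ : ∀ {X Y} (e : X ≡ Y) (p : P.F₀ X ≡ b) (q : P.F₀ Y ≡ b) →
                _≡_ {A = Pb.Obj} (X , p) (Y , q)
  fibre-obj-≡ refl p q = cong (_ ,_) (uip p q)

  fibre-≡⇒hom : ∀ {X Y} {p : P.F₀ X ≡ b} {q : P.F₀ Y ≡ b}
                (E : _≡_ {A = Pb.Obj} (X , p) (Y , q)) (e : X ≡ Y) →
                proj₁ (Pb.≡⇒hom E) E.≈ E.≡⇒hom e
  fibre-≡⇒hom refl refl = E.Equiv.refl

  fibre-isIso⇒isIso : ∀ {X Y} (f : X Pb.⇒ Y) →
                      CategoryLemmas.IsIso (Fibre P b) {X} {Y} f → E′.IsIso (proj₁ f)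
  fibre-isIso⇒isIso f I = record { inv = proj₁ I.inv ; isoˡ = I.isoˡ ; isoʳ = I.isoʳ }
    where module I = CategoryLemmas.IsIso I

  isIso⇒fibre-isIso : ∀ {X Y} (f : X Pb.⇒ Y) →
                      E′.IsIso (proj₁ f) → CategoryLemmas.IsIso (Fibre P b) {X} {Y} f
  isIso⇒fibre-isIso {X} {Y} f I = record
    { inv = fibre-hom {Y} {X} I.inv inv-vertical ; isoˡ = I.isoˡ ; isoʳ = I.isoʳ }
    where
      module I = E′.IsIso I
      inv-vertical : IsVertical P I.inv
      inv-vertical = P↓.isVertical-cancelʳ
        (P↓.isVertical-resp-≈ (E.Equiv.sym I.isoˡ) (P↓.≡⇒hom-isVertical refl))
        (fibre-hom-isVertical {X} {Y} f)

module CartesianLemmas {oE ℓE eE oB ℓB eB} {𝓔 : Category oE ℓE eE} {𝓑 : Category oB ℓB eB}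
                       (P : Functor 𝓔 𝓑) where
  private
    module E = Category 𝓔
    module B = Category 𝓑
    module P = Functor P
    module E′ = CategoryLemmas 𝓔
    module B′ = CategoryLemmas 𝓑

  factor-unique₂ : ∀ {X Y Z} {f : X E.⇒ Y} (C : IsCartesian P f)
                   {g : Z E.⇒ Y} {h : P.F₀ Z B.⇒ P.F₀ X} → P.F₁ g B.≈ P.F₁ f B.∘ h →
                   (k k′ : Z E.⇒ X) → P.F₁ k B.≈ h → f E.∘ k E.≈ g →
                   P.F₁ k′ B.≈ h → f E.∘ k′ E.≈ g → k E.≈ k′
  factor-unique₂ C {g} {h} eq k k′ kh kg k′h k′g =
    E.Equiv.trans (C.factor-unique g h eq k kh kg) (E.Equiv.sym (C.factor-unique g h eq k′ k′h k′g))
    where module C = IsCartesian C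

  cartesian-isIso : ∀ {X Y} {f : X E.⇒ Y} → IsCartesian P f → B′.IsIso (P.F₁ f) → E′.IsIso f
  cartesian-isIso {f = f} C I = record
    { inv = inv ; isoˡ = isoˡ ; isoʳ = C.factor-comm E.id I.inv id-over }
    where
      module C = IsCartesian C
      module I = B′.IsIso I
      id-over : P.F₁ E.id B.≈ P.F₁ f B.∘ I.inv
      id-over = B.Equiv.trans P.identity (B.Equiv.sym I.isoʳ)
      inv = C.factor E.id I.inv id-over
      isoˡ : inv E.∘ f E.≈ E.id
      isoˡ = factor-unique₂ C (B.Equiv.sym B.identityʳ) (inv E.∘ f) E.id
        (B.Equiv.trans P.homomorphism
          (B.Equiv.trans (B.∘-resp-≈ (C.factor-over E.id I.inv id-over) B.Equiv.refl) I.isoˡ))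
        (E.Equiv.trans (E.Equiv.sym E.assoc)
          (E.Equiv.trans (E.∘-resp-≈ (C.factor-comm E.id I.inv id-over) E.Equiv.refl) E.identityˡ))
        P.identity E.identityʳ

-- A left adjoint of R given pointwise; unlike Adjunction it asks for no functor, so it
-- restricts to fibres without reproving functoriality.
record UniversalArrows {o ℓ e o′ ℓ′ e′} {C : Category o ℓ e} {D : Category o′ ℓ′ e′}
                       (R : Functor C D) : Set (o ⊔ ℓ ⊔ e ⊔ o′ ⊔ ℓ′ ⊔ e′) where
  private
    module C = Category C
    module D = Category D
    module R = Functor R
  field
    Q₀ : D.Obj → C.Obj
    η : ∀ P → P D.⇒ R.F₀ (Q₀ P)
    transpose : ∀ {P Z} → P D.⇒ R.F₀ Z → Q₀ P C.⇒ Z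
    transpose-triangle : ∀ {P Z} (m : P D.⇒ R.F₀ Z) → R.F₁ (transpose m) D.∘ η P D.≈ m
    η-unique : ∀ {P Z} (g g′ : Q₀ P C.⇒ Z) →
               R.F₁ g D.∘ η P D.≈ R.F₁ g′ D.∘ η P → g C.≈ g′

module _ {o ℓ e o′ ℓ′ e′} {C : Category o ℓ e} {D : Category o′ ℓ′ e′}
         {R : Functor C D} (UA : UniversalArrows R)
         {F : Functor C C} {G : Functor D D} (θ : NatIso (G ∘F R) (R ∘F F)) where
  private
    module C = Category C
    module D = Category D
    module R = Functor R
    module F = Functor F
    module G = Functor G
    module θ = NatIso θ
    module D′ = CategoryLemmas D
    module DR {A B} = SetoidR (D.hom-setoid {A} {B})
    open UniversalArrows UA

  liftCoalgebraAlong : Coalgebra F → Coalgebra G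
  liftCoalgebraAlong (coalgebra X α) = coalgebra (R.F₀ X) (θ.⇐ X D.∘ R.F₁ α)

  module _ (X : C.Obj) (α : X C.⇒ F.F₀ X) (P : D.Obj) (β : P D.⇒ G.F₀ P) where

    reflectedStructure : Q₀ P C.⇒ F.F₀ (Q₀ P)
    reflectedStructure = transpose (θ.⇒ (Q₀ P) D.∘ (G.F₁ (η P) D.∘ β))

    lift-commutes : ∀ (k : P D.⇒ R.F₀ X) →
                    θ.⇒ X D.∘ (G.F₁ k D.∘ β) D.≈ R.F₁ α D.∘ k →
                    G.F₁ k D.∘ β D.≈ (θ.⇐ X D.∘ R.F₁ α) D.∘ k
    lift-commutes k c = D.Equiv.trans (D′.isIso-shiftˡ (natIso-isIso θ X) c) (D.Equiv.sym D.assoc)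

    lift-commutes⁻¹ : ∀ (k : P D.⇒ R.F₀ X) →
                      G.F₁ k D.∘ β D.≈ (θ.⇐ X D.∘ R.F₁ α) D.∘ k →
                      θ.⇒ X D.∘ (G.F₁ k D.∘ β) D.≈ R.F₁ α D.∘ k
    lift-commutes⁻¹ k c = D′.isIso-unshiftˡ (natIso-isIso θ X) (D.Equiv.trans c D.assoc)

    θ-transpose : ∀ (g : Q₀ P C.⇒ X) →
                  θ.⇒ X D.∘ (G.F₁ (R.F₁ g D.∘ η P) D.∘ β) D.≈
                  R.F₁ (F.F₁ g C.∘ reflectedStructure) D.∘ η P
    θ-transpose g = begin
      θ.⇒ X D.∘ (G.F₁ (R.F₁ g D.∘ η P) D.∘ β)
        ≈⟨ D.∘-resp-≈ D.Equiv.refl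
             (D.Equiv.trans (D.∘-resp-≈ G.homomorphism D.Equiv.refl) D.assoc) ⟩
      θ.⇒ X D.∘ (G.F₁ (R.F₁ g) D.∘ (G.F₁ (η P) D.∘ β))
        ≈⟨ D.Equiv.sym D.assoc ⟩
      (θ.⇒ X D.∘ G.F₁ (R.F₁ g)) D.∘ (G.F₁ (η P) D.∘ β)
        ≈⟨ D.Equiv.trans (D.∘-resp-≈ (θ.natural g) D.Equiv.refl) D.assoc ⟩
      R.F₁ (F.F₁ g) D.∘ (θ.⇒ (Q₀ P) D.∘ (G.F₁ (η P) D.∘ β))
        ≈⟨ D.∘-resp-≈ D.Equiv.refl (D.Equiv.sym (transpose-triangle _)) ⟩
      R.F₁ (F.F₁ g) D.∘ (R.F₁ reflectedStructure D.∘ η P)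
        ≈⟨ D.Equiv.trans (D.Equiv.sym D.assoc)
             (D.∘-resp-≈ (D.Equiv.sym R.homomorphism) D.Equiv.refl) ⟩
      R.F₁ (F.F₁ g C.∘ reflectedStructure) D.∘ η P ∎
      where open DR

    R-∘-η : ∀ (g : Q₀ P C.⇒ X) → R.F₁ (α C.∘ g) D.∘ η P D.≈ R.F₁ α D.∘ (R.F₁ g D.∘ η P)
    R-∘-η g = D.Equiv.trans (D.∘-resp-≈ R.homomorphism D.Equiv.refl) D.assoc

    transpose-isHom : ∀ (g : Q₀ P C.⇒ X) → F.F₁ g C.∘ reflectedStructure C.≈ α C.∘ g →
                      θ.⇒ X D.∘ (G.F₁ (R.F₁ g D.∘ η P) D.∘ β) D.≈ R.F₁ α D.∘ (R.F₁ g D.∘ η P)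
    transpose-isHom g c = D.Equiv.trans (θ-transpose g)
      (D.Equiv.trans (D.∘-resp-≈ (R.F-resp-≈ c) D.Equiv.refl) (R-∘-η g))

    transpose-isHom⁻¹ : ∀ (g : Q₀ P C.⇒ X) →
                        θ.⇒ X D.∘ (G.F₁ (R.F₁ g D.∘ η P) D.∘ β) D.≈ R.F₁ α D.∘ (R.F₁ g D.∘ η P) →
                        F.F₁ g C.∘ reflectedStructure C.≈ α C.∘ g
    transpose-isHom⁻¹ g c = η-unique _ _
      (D.Equiv.trans (D.Equiv.sym (θ-transpose g)) (D.Equiv.trans c (D.Equiv.sym (R-∘-η g))))

  liftCoalgebraAlong-terminal : ∀ T → IsTerminalCoalgebra F T →
                                IsTerminalCoalgebra G (liftCoalgebraAlong T)
  liftCoalgebraAlong-terminal (coalgebra X α) terminal (coalgebra P β) = k , k-unique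
    where
      reflected : Coalgebra F
      reflected = coalgebra (Q₀ P) (reflectedStructure X α P β)
      h = proj₁ (terminal reflected)
      module h = CoalgebraHom h
      k : CoalgebraHom G (coalgebra P β) (liftCoalgebraAlong (coalgebra X α))
      k = record
        { hom = R.F₁ h.hom D.∘ η P
        ; commutes = lift-commutes X α P β _ (transpose-isHom X α P β h.hom h.commutes) }
      k-unique : ∀ k′ → CoalgebraHom.hom k′ D.≈ R.F₁ h.hom D.∘ η P
      k-unique k′ = D.Equiv.trans (D.Equiv.sym (transpose-triangle k′.hom))
                      (D.∘-resp-≈ (R.F-resp-≈ (proj₂ (terminal reflected) g)) D.Equiv.refl)
        where
          module k′ = CoalgebraHom k′
          g : CoalgebraHom F reflected (coalgebra X α)
          g = record
            { hom = transpose k′.hom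
            ; commutes = transpose-isHom⁻¹ X α P β _
                (D.Equiv.trans (D.∘-resp-≈ D.Equiv.refl
                  (D.∘-resp-≈ (G.F-resp-≈ (transpose-triangle k′.hom)) D.Equiv.refl))
                (D.Equiv.trans (lift-commutes⁻¹ X α P β k′.hom k′.commutes)
                  (D.∘-resp-≈ D.Equiv.refl (D.Equiv.sym (transpose-triangle k′.hom))))) }

module AdjunctionLemmas {o ℓ e o′ ℓ′ e′} {C : Category o ℓ e} {D : Category o′ ℓ′ e′}
                        {L : Functor C D} {R : Functor D C} (adj : Adjunction L R) where
  private
    module C = Category C
    module D = Category D
    module L = Functor L
    module R = Functor R
    module C′ = CategoryLemmas C
    module CR {A B} = SetoidR (C.hom-setoid {A} {B})
    module DR {A B} = SetoidR (D.hom-setoid {A} {B})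
  open Adjunction adj

  transpose : ∀ {X Z} → X C.⇒ R.F₀ Z → L.F₀ X D.⇒ Z
  transpose {Z = Z} m = counit Z D.∘ L.F₁ m

  transpose-triangle : ∀ {X Z} (m : X C.⇒ R.F₀ Z) → R.F₁ (transpose m) C.∘ unit X C.≈ m
  transpose-triangle {X} {Z} m = begin
    R.F₁ (counit Z D.∘ L.F₁ m) C.∘ unit X
      ≈⟨ C.Equiv.trans (C.∘-resp-≈ R.homomorphism C.Equiv.refl) C.assoc ⟩
    R.F₁ (counit Z) C.∘ (R.F₁ (L.F₁ m) C.∘ unit X)
      ≈⟨ C.∘-resp-≈ C.Equiv.refl (unit-natural m) ⟩
    R.F₁ (counit Z) C.∘ (unit (R.F₀ Z) C.∘ m)
      ≈⟨ C.Equiv.sym C.assoc ⟩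
    (R.F₁ (counit Z) C.∘ unit (R.F₀ Z)) C.∘ m
      ≈⟨ C.Equiv.trans (C.∘-resp-≈ (zag Z) C.Equiv.refl) C.identityˡ ⟩
    m ∎
    where open CR

  transpose-unique : ∀ {X Z} (g : L.F₀ X D.⇒ Z) → g D.≈ transpose (R.F₁ g C.∘ unit X)
  transpose-unique {X} {Z} g = D.Equiv.sym (begin
    counit Z D.∘ L.F₁ (R.F₁ g C.∘ unit X)
      ≈⟨ D.Equiv.trans (D.∘-resp-≈ D.Equiv.refl L.homomorphism) (D.Equiv.sym D.assoc) ⟩
    (counit Z D.∘ L.F₁ (R.F₁ g)) D.∘ L.F₁ (unit X)
      ≈⟨ D.∘-resp-≈ (D.Equiv.sym (counit-natural g)) D.Equiv.refl ⟩
    (g D.∘ counit (L.F₀ X)) D.∘ L.F₁ (unit X)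
      ≈⟨ D.Equiv.trans D.assoc (D.∘-resp-≈ D.Equiv.refl (zig X)) ⟩
    g D.∘ D.id
      ≈⟨ D.identityʳ ⟩
    g ∎)
    where open DR

  unit-unique : ∀ {X Z} (g g′ : L.F₀ X D.⇒ Z) →
                R.F₁ g C.∘ unit X C.≈ R.F₁ g′ C.∘ unit X → g D.≈ g′
  unit-unique g g′ eq = D.Equiv.trans (transpose-unique g)
    (D.Equiv.trans (D.∘-resp-≈ D.Equiv.refl (L.F-resp-≈ eq)) (D.Equiv.sym (transpose-unique g′)))

  full⇒unit-isIso : FullyFaithful R → ∀ Y → C′.IsIso (unit (R.F₀ Y))
  full⇒unit-isIso ff Y = record { inv = R.F₁ (counit Y) ; isoˡ = zag Y ; isoʳ = isoʳ }
    where
      s = proj₁ (FullyFaithful.full ff (unit (R.F₀ Y)))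
      Rs≈unit : R.F₁ s C.≈ unit (R.F₀ Y)
      Rs≈unit = proj₂ (FullyFaithful.full ff (unit (R.F₀ Y)))
      s∘counit≈id : s D.∘ counit Y D.≈ D.id
      s∘counit≈id = unit-unique _ _ (begin
        R.F₁ (s D.∘ counit Y) C.∘ unit (R.F₀ Y)
          ≈⟨ C.Equiv.trans (C.∘-resp-≈ R.homomorphism C.Equiv.refl) C.assoc ⟩
        R.F₁ s C.∘ (R.F₁ (counit Y) C.∘ unit (R.F₀ Y))
          ≈⟨ C.Equiv.trans (C.∘-resp-≈ Rs≈unit (zag Y)) C.identityʳ ⟩
        unit (R.F₀ Y)
          ≈⟨ C.Equiv.sym (C.Equiv.trans (C.∘-resp-≈ R.identity C.Equiv.refl) C.identityˡ) ⟩
        R.F₁ D.id C.∘ unit (R.F₀ Y) ∎)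
        where open CR
      isoʳ : unit (R.F₀ Y) C.∘ R.F₁ (counit Y) C.≈ C.id
      isoʳ = begin
        unit (R.F₀ Y) C.∘ R.F₁ (counit Y) ≈⟨ C.∘-resp-≈ (C.Equiv.sym Rs≈unit) C.Equiv.refl ⟩
        R.F₁ s C.∘ R.F₁ (counit Y)        ≈⟨ C.Equiv.sym R.homomorphism ⟩
        R.F₁ (s D.∘ counit Y)             ≈⟨ C.Equiv.trans (R.F-resp-≈ s∘counit≈id) R.identity ⟩
        C.id ∎
        where open CR

module _ {o ℓ e} (C : Category o ℓ e) where
  private
    module CR {A B} = SetoidR (Category.hom-setoid C {A} {B})
  open Category C

  Arrow : Category (o ⊔ ℓ) (ℓ ⊔ e) e
  Arrow = record
    { Obj = Arr C
    ; _⇒_ = Square C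
    ; _≈_ = λ s t → Square.top s ≈ Square.top t × Square.bot s ≈ Square.bot t
    ; id = square id id (Equiv.trans identityˡ (Equiv.sym identityʳ))
    ; _∘_ = λ t s → square (Square.top t ∘ Square.top s) (Square.bot t ∘ Square.bot s)
                           (paste (Square.comm s) (Square.comm t))
    ; equiv = record
      { refl = Equiv.refl , Equiv.refl
      ; sym = λ (p , q) → Equiv.sym p , Equiv.sym q
      ; trans = λ (p , q) (p′ , q′) → Equiv.trans p p′ , Equiv.trans q q′ }
    ; ∘-resp-≈ = λ (p , q) (p′ , q′) → ∘-resp-≈ p p′ , ∘-resp-≈ q q′
    ; identityˡ = identityˡ , identityˡ
    ; identityʳ = identityʳ , identityʳ
    ; assoc = assoc , assoc
    }
    where
      paste : ∀ {A B A′ B′ A″ B″} {f : A ⇒ B} {g : A′ ⇒ B′} {h : A″ ⇒ B″}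
                {t₁ : A ⇒ A′} {b₁ : B ⇒ B′} {t₂ : A′ ⇒ A″} {b₂ : B′ ⇒ B″} →
              b₁ ∘ f ≈ g ∘ t₁ → b₂ ∘ g ≈ h ∘ t₂ → (b₂ ∘ b₁) ∘ f ≈ h ∘ (t₂ ∘ t₁)
      paste {f = f} {g} {h} {t₁} {b₁} {t₂} {b₂} sq₁ sq₂ = begin
        (b₂ ∘ b₁) ∘ f ≈⟨ Equiv.trans assoc (∘-resp-≈ Equiv.refl sq₁) ⟩
        b₂ ∘ (g ∘ t₁) ≈⟨ Equiv.trans (Equiv.sym assoc) (∘-resp-≈ sq₂ Equiv.refl) ⟩
        (h ∘ t₂) ∘ t₁ ≈⟨ assoc ⟩
        h ∘ (t₂ ∘ t₁) ∎
        where open CR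

module _ {o ℓ e o′ ℓ′ e′} {C : Category o ℓ e} {D : Category o′ ℓ′ e′}
         (F : Functor C D) where
  open Functor F

  arrowFunctor : Functor (Arrow C) (Arrow D)
  arrowFunctor = record
    { F₀ = F→₀ F
    ; F₁ = F→₁ F
    ; isFunctor = record
      { identity = identity , identity
      ; homomorphism = homomorphism , homomorphism
      ; F-resp-≈ = λ (p , q) → F-resp-≈ p , F-resp-≈ q } }

module WeakQCEFibreLemmas
  {oA ℓA eA oB ℓB eB oE ℓE eE}
  {𝓐 : Category oA ℓA eA} {𝓑 : Category oB ℓB eB} {𝓔 : Category oE ℓE eE}
  (r : Functor 𝓑 𝓐) (U : Functor 𝓔 𝓑)
  (fibU : Fibration U) (W : WeakQCE r U)
  (a : Category.Obj 𝓐) where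

  open WeakQCEFibre r U fibU W a
  private
    module B = Category 𝓑
    module 𝓔 = Category 𝓔
    module 𝓑ₐ = Category 𝓑ₐ
    module 𝓔ₐ = Category 𝓔ₐ
    module r = Functor r
    module U = Functor U
    module Uₐ = Functor Uₐ
    module Eₐ = Functor Eₐ
    module W = WeakQCE W
    module E = Functor W.E
    module Q = Functor W.Q
    module UE = FunctorEq W.UE≡Id
    module Adj = AdjunctionLemmas W.Q⊣E
    module r↓ = VerticalLemmas r
    module rU↓ = VerticalLemmas (r ∘F U)
    module 𝓑ₐ↓ = FibreLemmas r a
    module 𝓔ₐ↓ = FibreLemmas (r ∘F U) a
    module B′ = CategoryLemmas 𝓑
    module 𝓑ₐ′ = CategoryLemmas 𝓑ₐ
    module 𝓔ₐ′ = CategoryLemmas 𝓔ₐ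
    module ER {X Y} = SetoidR (𝓔.hom-setoid {X} {Y})
    module BR {X Y} = SetoidR (B.hom-setoid {X} {Y})
    open CartesianLemmas U using (cartesian-isIso)

  E-reflects-isVertical : ∀ {X Y} {g : X B.⇒ Y} → IsVertical (r ∘F U) (E.F₁ g) → IsVertical r g
  E-reflects-isVertical {X} {Y} {g} v = r↓.isVertical-cancelʳ
    (r↓.isVertical-resp-≈ (UE.eq₁ g) (r↓.isVertical-∘ (r↓.≡⇒hom-isVertical (ue Y)) v))
    (r↓.≡⇒hom-isVertical (ue X))

  Eₐ-universalArrows : UniversalArrows Eₐ
  Eₐ-universalArrows = record
    { Q₀ = Q₀
    ; η = λ P → 𝓔ₐ↓.fibre-hom {P} {Eₐ.F₀ (Q₀ P)} (Adjunction.unit W.Q⊣E (proj₁ P))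
                               (W.unit-vertical (proj₁ P))
    ; transpose = λ {P} {Z} m →
        𝓑ₐ↓.fibre-hom {Q₀ P} {Z} (Adj.transpose (proj₁ m)) (transpose-vertical {P} {Z} m)
    ; transpose-triangle = λ m → Adj.transpose-triangle (proj₁ m)
    ; η-unique = λ g g′ → Adj.unit-unique (proj₁ g) (proj₁ g′)
    }
    where
      Q₀ : 𝓔ₐ.Obj → 𝓑ₐ.Obj
      Q₀ (P , p) = Q.F₀ P , PE.trans (PE.sym (cong r.F₀ (ue (Q.F₀ P))))
                                     (PE.trans (PE.sym (proj₁ (W.unit-vertical P))) p)
      transpose-vertical : ∀ {P Z} (m : P 𝓔ₐ.⇒ Eₐ.F₀ Z) → IsVertical r (Adj.transpose (proj₁ m))
      transpose-vertical {P} {Z} m = E-reflects-isVertical (rU↓.isVertical-cancelʳ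
        (rU↓.isVertical-resp-≈ (𝓔.Equiv.sym (Adj.transpose-triangle (proj₁ m)))
                               (𝓔ₐ↓.fibre-hom-isVertical {P} {Eₐ.F₀ Z} m))
        (W.unit-vertical (proj₁ P)))

  lifting-sound : (F : Functor 𝓑ₐ 𝓑ₐ) (F̌ : Functor 𝓔ₐ 𝓔ₐ) (L : IsEₐPreservingLifting F F̌) →
                   SoundCoinduction L
  lifting-sound F F̌ L =
    liftCoalgebraAlong-terminal Eₐ-universalArrows (IsEₐPreservingLifting.preservesE L)

  J-dom-over : (f : Arr 𝓑ₐ) → U.F₀ (proj₁ (J₀ f)) ≡ proj₁ (Arr.src f)
  J-dom-over f = CartesianLift.dom-over (Jlift f)

  module _ {f g : Arr 𝓑ₐ} (s : Square 𝓑ₐ f g) where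
    private
      module Lf = CartesianLift (Jlift f)
      module Lg = CartesianLift (Jlift g)
      module Lg-cart = IsCartesian Lg.arr-cartesian

    J₁-over : U.F₁ (proj₁ (J₁ s)) B.≈ B′.conjugate Lf.dom-over Lg.dom-over (proj₁ (Square.top s))
    J₁-over = Lg-cart.factor-over _ _ _

    J₁-comm : Lg.arr 𝓔.∘ proj₁ (J₁ s) 𝓔.≈ E.F₁ (proj₁ (Square.bot s)) 𝓔.∘ Lf.arr
    J₁-comm = Lg-cart.factor-comm _ _ _

    J₁-unique : ∀ (k : Lf.dom 𝓔.⇒ Lg.dom) →
                U.F₁ k B.≈ B′.conjugate Lf.dom-over Lg.dom-over (proj₁ (Square.top s)) →
                Lg.arr 𝓔.∘ k 𝓔.≈ E.F₁ (proj₁ (Square.bot s)) 𝓔.∘ Lf.arr →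
                k 𝓔.≈ proj₁ (J₁ s)
    J₁-unique k = Lg-cart.factor-unique _ _ _ k

  Jₐ : Functor (Arrow 𝓑ₐ) 𝓔ₐ
  Jₐ = record
    { F₀ = J₀
    ; F₁ = J₁
    ; isFunctor = record
      { identity = λ {f} → 𝓔.Equiv.sym (J₁-unique (Category.id (Arrow 𝓑ₐ) {f}) 𝓔.id
          (B.Equiv.trans U.identity (B.Equiv.sym (B′.conjugate-id (J-dom-over f))))
          (𝓔.Equiv.trans 𝓔.identityʳ
            (𝓔.Equiv.sym (𝓔.Equiv.trans (𝓔.∘-resp-≈ E.identity 𝓔.Equiv.refl) 𝓔.identityˡ))))
      ; homomorphism = λ {f} {g} {h} {s} {t} → 𝓔.Equiv.sym (J₁-∘ s t)
      ; F-resp-≈ = λ {f} {g} {s} {s′} (top≈ , bot≈) → J₁-unique s′ (proj₁ (J₁ s))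
          (B.Equiv.trans (J₁-over s) (B′.conjugate-resp-≈ (J-dom-over f) (J-dom-over g) top≈))
          (𝓔.Equiv.trans (J₁-comm s) (𝓔.∘-resp-≈ (E.F-resp-≈ bot≈) 𝓔.Equiv.refl))
      } }
    where
      J₁-∘ : ∀ {f g h} (s : Square 𝓑ₐ f g) (t : Square 𝓑ₐ g h) →
             proj₁ (J₁ t) 𝓔.∘ proj₁ (J₁ s) 𝓔.≈ proj₁ (J₁ (Category._∘_ (Arrow 𝓑ₐ) t s))
      J₁-∘ {f} {g} {h} s t = J₁-unique (Category._∘_ (Arrow 𝓑ₐ) t s) _
        (B.Equiv.trans U.homomorphism
          (B.Equiv.trans (B.∘-resp-≈ (J₁-over t) (J₁-over s))
            (B′.conjugate-∘ (J-dom-over f) (J-dom-over g) (J-dom-over h) _ _)))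
        (begin
          Lh.arr 𝓔.∘ (proj₁ (J₁ t) 𝓔.∘ proj₁ (J₁ s))
            ≈⟨ 𝓔.Equiv.trans (𝓔.Equiv.sym 𝓔.assoc) (𝓔.∘-resp-≈ (J₁-comm t) 𝓔.Equiv.refl) ⟩
          (E.F₁ (proj₁ (Square.bot t)) 𝓔.∘ Lg.arr) 𝓔.∘ proj₁ (J₁ s)
            ≈⟨ 𝓔.Equiv.trans 𝓔.assoc (𝓔.∘-resp-≈ 𝓔.Equiv.refl (J₁-comm s)) ⟩
          E.F₁ (proj₁ (Square.bot t)) 𝓔.∘ (E.F₁ (proj₁ (Square.bot s)) 𝓔.∘ Lf.arr)
            ≈⟨ 𝓔.Equiv.trans (𝓔.Equiv.sym 𝓔.assoc)
                 (𝓔.∘-resp-≈ (𝓔.Equiv.sym E.homomorphism) 𝓔.Equiv.refl) ⟩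
          E.F₁ (proj₁ (Square.bot t) B.∘ proj₁ (Square.bot s)) 𝓔.∘ Lf.arr ∎)
        where
          open ER
          module Lf = CartesianLift (Jlift f)
          module Lg = CartesianLift (Jlift g)
          module Lh = CartesianLift (Jlift h)

  J-arr : (f : Arr 𝓑ₐ) → J₀ f 𝓔ₐ.⇒ Eₐ.F₀ (Arr.tgt f)
  J-arr f = 𝓔ₐ↓.fibre-hom {J₀ f} {Eₐ.F₀ (Arr.tgt f)} L.arr
    (r↓.isVertical-resp-≈ (B.Equiv.sym L.arr-over)
      (r↓.isVertical-∘
        (r↓.isVertical-∘ (r↓.≡⇒hom-isVertical (PE.sym (ue (proj₁ (Arr.tgt f)))))
                         (𝓑ₐ↓.fibre-hom-isVertical {Arr.src f} {Arr.tgt f} (Arr.arr f)))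
        (r↓.≡⇒hom-isVertical L.dom-over)))
    where module L = CartesianLift (Jlift f)

  J-arr-isIso : (f : Arr 𝓑ₐ) → 𝓑ₐ′.IsIso (Arr.arr f) → 𝓔ₐ′.IsIso (J-arr f)
  J-arr-isIso f iso = 𝓔ₐ↓.isIso⇒fibre-isIso {J₀ f} {Eₐ.F₀ (Arr.tgt f)} (J-arr f)
    (cartesian-isIso L.arr-cartesian (B′.isIso-resp-≈ (B.Equiv.sym L.arr-over)
      (B′.isIso-∘ (B′.isIso-∘ (B′.≡⇒hom-isIso (PE.sym (ue (proj₁ (Arr.tgt f)))))
                              (𝓑ₐ↓.fibre-isIso⇒isIso {Arr.src f} {Arr.tgt f} (Arr.arr f) iso))
                  (B′.≡⇒hom-isIso L.dom-over))))
    where module L = CartesianLift (Jlift f)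

  ρₐ : Functor 𝓔ₐ (Arrow 𝓑ₐ)
  ρₐ = record
    { F₀ = ρ₀
    ; F₁ = ρ₁
    ; isFunctor = record
      { identity = U.identity , UEQ.identity
      ; homomorphism = U.homomorphism , UEQ.homomorphism
      ; F-resp-≈ = λ f≈g → U.F-resp-≈ f≈g , UEQ.F-resp-≈ f≈g } }
    where module UEQ = Functor (U ∘F W.E ∘F W.Q)

  -- JFρ₀ F and JFρ₁ F are definitionally the two parts of this composite.
  JFρ-isFunctor : (F : Functor 𝓑ₐ 𝓑ₐ) → IsFunctor 𝓔ₐ 𝓔ₐ (JFρ₀ F) (JFρ₁ F)
  JFρ-isFunctor F = Functor.isFunctor (Jₐ ∘F arrowFunctor F ∘F ρₐ)

  J-src : (f : Arr 𝓑ₐ) → Uₐ.F₀ (J₀ f) ≡ Arr.src f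
  J-src f = 𝓑ₐ↓.fibre-obj-≡ (J-dom-over f) _ _

  J-lies-over : ∀ {f g} (s : Square 𝓑ₐ f g) →
                proj₁ (𝓑ₐ.≡⇒hom (J-src g)) B.∘ U.F₁ (proj₁ (J₁ s)) B.≈
                proj₁ (Square.top s) B.∘ proj₁ (𝓑ₐ.≡⇒hom (J-src f))
  J-lies-over {f} {g} s = begin
    proj₁ (𝓑ₐ.≡⇒hom (J-src g)) B.∘ U.F₁ (proj₁ (J₁ s))
      ≈⟨ B.∘-resp-≈ (𝓑ₐ↓.fibre-≡⇒hom (J-src g) (J-dom-over g)) (J₁-over s) ⟩
    B.≡⇒hom (J-dom-over g) B.∘ B′.conjugate (J-dom-over f) (J-dom-over g) (proj₁ (Square.top s))
      ≈⟨ B′.≡⇒hom-∘-conjugate (J-dom-over f) (J-dom-over g) _ ⟩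
    proj₁ (Square.top s) B.∘ B.≡⇒hom (J-dom-over f)
      ≈⟨ B.∘-resp-≈ B.Equiv.refl (B.Equiv.sym (𝓑ₐ↓.fibre-≡⇒hom (J-src f) (J-dom-over f))) ⟩
    proj₁ (Square.top s) B.∘ proj₁ (𝓑ₐ.≡⇒hom (J-src f)) ∎
    where open BR

  UₐEₐ-obj : ∀ Y → Functor.F₀ (Uₐ ∘F Eₐ) Y ≡ Y
  UₐEₐ-obj (X , p) = 𝓑ₐ↓.fibre-obj-≡ (ue X) _ p

  UₐEₐ≡Id : FunctorEq (Uₐ ∘F Eₐ) (idF 𝓑ₐ)
  UₐEₐ≡Id = record
    { eq₀ = UₐEₐ-obj
    ; eq₁ = λ { {X , p} {Y , q} (f , _) →
        B.Equiv.trans (B.∘-resp-≈ (𝓑ₐ↓.fibre-≡⇒hom (UₐEₐ-obj (Y , q)) (ue Y)) B.Equiv.refl)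
          (B.Equiv.trans (UE.eq₁ f)
            (B.∘-resp-≈ B.Equiv.refl (B.Equiv.sym (𝓑ₐ↓.fibre-≡⇒hom (UₐEₐ-obj (X , p)) (ue X))))) } }

  ρEₐ-isIso : ∀ Y → 𝓑ₐ′.IsIso {Arr.src (ρ₀ (Eₐ.F₀ Y))} {Arr.tgt (ρ₀ (Eₐ.F₀ Y))}
                               (Arr.arr (ρ₀ (Eₐ.F₀ Y)))
  ρEₐ-isIso Y = 𝓑ₐ↓.isIso⇒fibre-isIso {Arr.src (ρ₀ (Eₐ.F₀ Y))} {Arr.tgt (ρ₀ (Eₐ.F₀ Y))}
    (Arr.arr (ρ₀ (Eₐ.F₀ Y)))
    (FunctorPreservation.F-resp-isIso U (Adj.full⇒unit-isIso W.E-fullyFaithful (proj₁ Y)))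

  ρEₐ⁻¹ : ∀ Y → Arr.tgt (ρ₀ (Eₐ.F₀ Y)) 𝓑ₐ.⇒ Y
  ρEₐ⁻¹ Y = 𝓑ₐ._∘_ {Arr.tgt (ρ₀ (Eₐ.F₀ Y))} {Arr.src (ρ₀ (Eₐ.F₀ Y))} {Y}
                   (𝓑ₐ.≡⇒hom (UₐEₐ-obj Y)) (𝓑ₐ′.IsIso.inv (ρEₐ-isIso Y))

  ρEₐ⁻¹-isIso : ∀ Y → 𝓑ₐ′.IsIso {Arr.tgt (ρ₀ (Eₐ.F₀ Y))} {Y} (ρEₐ⁻¹ Y)
  ρEₐ⁻¹-isIso Y = 𝓑ₐ′.isIso-∘ (𝓑ₐ′.≡⇒hom-isIso (UₐEₐ-obj Y)) (𝓑ₐ′.inv-isIso (ρEₐ-isIso Y))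

  ρEₐ⁻¹-natural : ∀ {Y Y′} (f : Y 𝓑ₐ.⇒ Y′) →
                  proj₁ (ρEₐ⁻¹ Y′) B.∘
                    proj₁ (Square.bot (ρ₁ {Eₐ.F₀ Y} {Eₐ.F₀ Y′} (Eₐ.F₁ f)))
                  B.≈ proj₁ f B.∘ proj₁ (ρEₐ⁻¹ Y)
  ρEₐ⁻¹-natural {Y} {Y′} f = begin
    (σ′ B.∘ ρ′⁻¹) B.∘ b ≈⟨ B.assoc ⟩
    σ′ B.∘ (ρ′⁻¹ B.∘ b) ≈⟨ B.∘-resp-≈ B.Equiv.refl
                             (𝓑ₐ′.inverse-commutes {u = Square.top sq} {v = Square.bot sq}
                                (ρEₐ-isIso Y) (ρEₐ-isIso Y′) (Square.comm sq)) ⟩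
    σ′ B.∘ (t B.∘ ρ⁻¹)  ≈⟨ B.Equiv.sym B.assoc ⟩
    (σ′ B.∘ t) B.∘ ρ⁻¹  ≈⟨ B.∘-resp-≈ (FunctorEq.eq₁ UₐEₐ≡Id f) B.Equiv.refl ⟩
    (proj₁ f B.∘ σ) B.∘ ρ⁻¹ ≈⟨ B.assoc ⟩
    proj₁ f B.∘ (σ B.∘ ρ⁻¹) ∎
    where
      open BR
      sq = ρ₁ {Eₐ.F₀ Y} {Eₐ.F₀ Y′} (Eₐ.F₁ f)
      b = proj₁ (Square.bot sq)
      t = proj₁ (Square.top sq)
      σ = proj₁ (𝓑ₐ.≡⇒hom (UₐEₐ-obj Y))
      σ′ = proj₁ (𝓑ₐ.≡⇒hom (UₐEₐ-obj Y′))
      ρ⁻¹ = proj₁ (𝓑ₐ′.IsIso.inv (ρEₐ-isIso Y))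
      ρ′⁻¹ = proj₁ (𝓑ₐ′.IsIso.inv (ρEₐ-isIso Y′))

  module _ (F : Functor 𝓑ₐ 𝓑ₐ) where
    private
      EF = Eₐ ∘F F
      module EF = Functor EF

    JFρ : Functor 𝓔ₐ 𝓔ₐ
    JFρ = mkFunctor (JFρ₀ F) (JFρ₁ F) (JFρ-isFunctor F)

    JFρ-lifts : FunctorEq (Uₐ ∘F JFρ) (F ∘F Uₐ)
    JFρ-lifts = record
      { eq₀ = λ P → J-src (F→₀ F (ρ₀ P))
      ; eq₁ = λ {P} {P′} f → J-lies-over (F→₁ F (ρ₁ {P} {P′} f)) }

    private
      ρFEₐ : ∀ Y → Arr 𝓑ₐ
      ρFEₐ Y = F→₀ F (ρ₀ (Eₐ.F₀ Y))

    JFρEₐ⇒EₐF : ∀ Y → JFρ₀ F (Eₐ.F₀ Y) 𝓔ₐ.⇒ EF.F₀ Y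
    JFρEₐ⇒EₐF Y = 𝓔ₐ._∘_ {JFρ₀ F (Eₐ.F₀ Y)} {Eₐ.F₀ (Arr.tgt (ρFEₐ Y))}
                         {EF.F₀ Y}
                         (EF.F₁ (ρEₐ⁻¹ Y)) (J-arr (ρFEₐ Y))

    JFρEₐ⇒EₐF-isIso : ∀ Y → 𝓔ₐ′.IsIso {JFρ₀ F (Eₐ.F₀ Y)} {EF.F₀ Y} (JFρEₐ⇒EₐF Y)
    JFρEₐ⇒EₐF-isIso Y = 𝓔ₐ′.isIso-∘
      (FunctorPreservation.F-resp-isIso EF (ρEₐ⁻¹-isIso Y))
      (J-arr-isIso (ρFEₐ Y) (FunctorPreservation.F-resp-isIso F (ρEₐ-isIso Y)))

    JFρEₐ⇒EₐF-natural : ∀ {Y Y′} (f : Y 𝓑ₐ.⇒ Y′) →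
      proj₁ (JFρEₐ⇒EₐF Y′) 𝓔.∘ proj₁ (JFρ₁ F {Eₐ.F₀ Y} {Eₐ.F₀ Y′} (Eₐ.F₁ f))
      𝓔.≈ proj₁ (EF.F₁ f) 𝓔.∘ proj₁ (JFρEₐ⇒EₐF Y)
    JFρEₐ⇒EₐF-natural {Y} {Y′} f = begin
      (EFπ′ 𝓔.∘ arr′) 𝓔.∘ proj₁ (J₁ s)   ≈⟨ 𝓔.assoc ⟩
      EFπ′ 𝓔.∘ (arr′ 𝓔.∘ proj₁ (J₁ s))   ≈⟨ 𝓔.∘-resp-≈ 𝓔.Equiv.refl (J₁-comm s) ⟩
      EFπ′ 𝓔.∘ (EFb 𝓔.∘ arr)             ≈⟨ 𝓔.Equiv.sym 𝓔.assoc ⟩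
      (EFπ′ 𝓔.∘ EFb) 𝓔.∘ arr             ≈⟨ 𝓔.∘-resp-≈ EF-square 𝓔.Equiv.refl ⟩
      (EFf 𝓔.∘ EFπ) 𝓔.∘ arr              ≈⟨ 𝓔.assoc ⟩
      EFf 𝓔.∘ (EFπ 𝓔.∘ arr)              ∎
      where
        open ER
        EY = Eₐ.F₀ Y
        EY′ = Eₐ.F₀ Y′
        ρEf = ρ₁ {EY} {EY′} (Eₐ.F₁ f)
        s = F→₁ F ρEf
        arr = CartesianLift.arr (Jlift (ρFEₐ Y))
        arr′ = CartesianLift.arr (Jlift (ρFEₐ Y′))
        EFπ = proj₁ (EF.F₁ (ρEₐ⁻¹ Y))
        EFπ′ = proj₁ (EF.F₁ (ρEₐ⁻¹ Y′))
        EFb = proj₁ (EF.F₁ (Square.bot ρEf))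
        EFf = proj₁ (EF.F₁ f)
        EF-square : EFπ′ 𝓔.∘ EFb 𝓔.≈ EFf 𝓔.∘ EFπ
        EF-square = FunctorPreservation.F-resp-square EF
          {Arr.tgt (ρ₀ EY)} {Arr.tgt (ρ₀ EY′)} {Y} {Y′}
          {f = Square.bot ρEf} {g = ρEₐ⁻¹ Y′} {h = ρEₐ⁻¹ Y} {k = f} (ρEₐ⁻¹-natural f)

    JFρ-lifting : IsEₐPreservingLifting F JFρ
    JFρ-lifting = record
      { lifts = JFρ-lifts
      ; preservesE = record
        { ⇒ = JFρEₐ⇒EₐF
        ; ⇐ = λ Y → 𝓔ₐ′.IsIso.inv (JFρEₐ⇒EₐF-isIso Y)
        ; isoˡ = λ Y → 𝓔ₐ′.IsIso.isoˡ (JFρEₐ⇒EₐF-isIso Y)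
        ; isoʳ = λ Y → 𝓔ₐ′.IsIso.isoʳ (JFρEₐ⇒EₐF-isIso Y)
        ; natural = JFρEₐ⇒EₐF-natural } }

corollary7p4 : ∀ {oA ℓA eA oB ℓB eB oE ℓE eE : Level}
    {𝓐 : Category oA ℓA eA} {𝓑 : Category oB ℓB eB} {𝓔 : Category oE ℓE eE}
    (r : Functor 𝓑 𝓐) (U : Functor 𝓔 𝓑) →
    Fibration r → (fibU : Fibration U) → (W : WeakQCE r U) →
    (a : Category.Obj 𝓐) →
    let open WeakQCEFibre r U fibU W a in
    (F : Functor 𝓑ₐ 𝓑ₐ) →
    (νF : Coalgebra F) → IsTerminalCoalgebra F νF →
    ((F̌ : Functor 𝓔ₐ 𝓔ₐ) (L : IsEₐPreservingLifting F F̌) → SoundCoinduction L)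
    × (Σ[ isF ∈ IsFunctor 𝓔ₐ 𝓔ₐ (JFρ₀ F) (JFρ₁ F) ]
    Σ[ L ∈ IsEₐPreservingLifting F (mkFunctor (JFρ₀ F) (JFρ₁ F) isF) ]
    SoundCoinduction L)
corollary7p4 r U _ fibU W a F _ _ =
  lifting-sound F , JFρ-isFunctor F , JFρ-lifting F , lifting-sound F (JFρ F) (JFρ-lifting F)
  where open WeakQCEFibreLemmas r U fibU W a
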